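{- Let $G=(K,S)$ be a split graph and let $H$ be an induced subgraph of $G$ isomorphic to the tent, with $V(H)=\{k_1,k_3,k_5,s_{13},s_{35},s_{51}\}$, $k_1,k_3,k_5\in K$, $s_{13},s_{35},s_{51}\in S$, where the neighbours of $s_{ij}$ in $H$ are exactly $k_i$ and $k_j$. For $i\in\{1,3,5\}$ let $K_i$ be the set of vertices of $K$ whose neighbours in $\{s_{13},s_{35},s_{51}\}$ are exactly $s_{(i-2)i}$ and $s_{i(i+2)}$, and for $i\in\{2,4,6\}$ let $K_i$ be the set of vertices of $K$ whose only neighbour in $\{s_{13},s_{35},s_{51}\}$ is $s_{(i-1)(i+1)}$ (indices modulo $6$, with $s_{ij}=s_{ji}$). If $G$ contains no induced subgraph isomorphic to a graph in $\mathcal{T}$ or $\mathcal{F}$, then $\{K_1,K_2,\dots,K_6\}$ is a partition of $K$ (some parts possibly empty).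
   Context: A split graph $G=(K,S)$ has vertex set partitioned into a clique $K$ and an independent set $S$. For an $n\times m$ $(0,1)$-matrix $M$, $G(M)$ is the split graph with clique $\{k_1,\dots,k_m\}$, independent set $\{s_1,\dots,s_n\}$, and $s_ik_j$ an edge iff $M_{ij}=1$. The $k$-sun ($k\ge3$): clique $v_1,\dots,v_k$, independent $w_1,\dots,w_k$, $w_i$ adjacent exactly to $v_i,v_{i+1}$ (mod $k$); the tent is the $3$-sun; an odd $k$-sun with center adds a vertex adjacent exactly to $v_1,\dots,v_k$; tent$\vee K_1$ is the tent plus a vertex adjacent to all its vertices. Matrices: $M_I(k)$ ($k\times k$, $k\ge3$): row $i$ has $1$'s exactly in columns $i,i+1$ (mod $k$). $M_{II}(k)$ ($k\times k$, $k\ge4$): row $1$ is $0$ in column $1$, $1$ elsewhere; rows $2\le j\le k-1$ have $1$'s exactly in columns $j-1,j$; row $k$ is $1$ except in column $k-1$. $M_{III}(k)$ ($k\times(k+1)$, $k\ge3$): rows $1\le j\le k-1$ have $1$'s exactly in columns $j,j+1$; row $k$ has $1$'s exactly in columns $2,\dots,k-1,k+1$. $M_{IV}$: rows $110000,001100,000011,010101$. $M_V$: rows $11000,00110,11110,10011$ (these are the Tucker matrices). $F_0$: rows $11100,01110,00111$. For odd $k\ge5$: $F_1(k)$ ($k\times(k-1)$): row $1$ is $0$ in column $1$, $1$ elsewhere; row $2$ is $1$ except in column $k-1$; rows $3\le j\le k$ have $1$'s exactly in columns $k-j+1,k-j+2$. $F_2(k)$ ($k\times k$): row $1$ has $1$'s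 exactly in columns $2,\dots,k-1$; rows $2\le j\le k$ have $1$'s exactly in columns $j-1,j$. $\mathcal{T}$: tent$\vee K_1$, all odd $k$-suns with center, and all $G(M)$ with $M$ a Tucker matrix other than $M_I(k)$ for odd $k$ and $M_{III}(k)$ for odd $k\ge5$. $\mathcal{F}$: $G(F_0)$, $G(F_1(k))$, $G(F_2(k))$ for odd $k\ge5$. -}

module Defs where

open import Data.Nat using (ℕ; zero; suc; _+_; _*_; _∸_; _≤_; _≡ᵇ_; _≤ᵇ_)
open import Data.Fin using (Fin; toℕ)
open import Data.Bool using (Bool; true; false; _∧_; _∨_; not; if_then_else_)
open import Data.Vec using (Vec; []; _∷_; lookup)
open import Data.Sum using (_⊎_; inj₁; inj₂)
open import Data.Unit using (⊤; tt)
open import Data.Product using (Σ; ∃; _×_; _,_; ∃!)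
open import Relation.Binary.PropositionalEquality using (_≡_; _≢_)
open import Relation.Nullary using (¬_)
open import Function.Definitions using (Injective)

IsSimpleGraph : {V : Set} → (V → V → Bool) → Set
IsSimpleGraph {V} adj = (∀ (u v : V) → adj u v ≡ adj v u) × (∀ (v : V) → adj v v ≡ false)

-- split graph G = (K , S): inK v ≡ true means v ∈ K, otherwise v ∈ S.
IsSplit : {n : ℕ} → (Fin n → Fin n → Bool) → (Fin n → Bool) → Set
IsSplit {n} adj inK =
  (∀ (u v : Fin n) → u ≢ v → inK u ≡ true → inK v ≡ true → adj u v ≡ true) ×
  (∀ (u v : Fin n) → inK u ≡ false → inK v ≡ false → adj u v ≡ false)

Embeds : {V : Set} {n : ℕ} → (V → V → Bool) → (Fin n → Fin n → Bool) → Set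
Embeds {V} {n} H G =
  Σ (V → Fin n) λ f → Injective _≡_ _≡_ f × (∀ (x y : V) → G (f x) (f y) ≡ H x y)

Odd : ℕ → Set
Odd k = ∃ λ t → k ≡ suc (2 * t)

-- Matrices (0,1) as Fin r → Fin c → Bool, and the split graph G(M):
-- inj₁ i = s_{i+1} (rows, independent set), inj₂ j = k_{j+1} (columns, clique).

GM : {r c : ℕ} → (Fin r → Fin c → Bool) → (Fin r ⊎ Fin c) → (Fin r ⊎ Fin c) → Bool
GM M (inj₁ i) (inj₁ i') = false
GM M (inj₂ j) (inj₂ j') = not (toℕ j ≡ᵇ toℕ j')
GM M (inj₁ i) (inj₂ j) = M i j
GM M (inj₂ j) (inj₁ i) = M i j

-- build a matrix from a formula on 1-based indices (row i, column j)
mat : (r c : ℕ) → (ℕ → ℕ → Bool) → Fin r → Fin c → Bool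
mat r c f i j = f (suc (toℕ i)) (suc (toℕ j))

matV : {r c : ℕ} → Vec (Vec Bool c) r → Fin r → Fin c → Bool
matV rows i j = lookup (lookup rows i) j

_∈[_,_] : ℕ → ℕ → ℕ → Bool
j ∈[ a , b ] = (a ≤ᵇ j) ∧ (j ≤ᵇ b)

MI : (k : ℕ) → Fin k → Fin k → Bool
MI k = mat k k λ i j → (j ≡ᵇ i) ∨ (j ≡ᵇ suc i) ∨ ((i ≡ᵇ k) ∧ (j ≡ᵇ 1))

MII : (k : ℕ) → Fin k → Fin k → Bool
MII k = mat k k λ i j →
  if i ≡ᵇ 1 then not (j ≡ᵇ 1)
  else if i ≡ᵇ k then not (j ≡ᵇ (k ∸ 1))
  else ((j ≡ᵇ (i ∸ 1)) ∨ (j ≡ᵇ i))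

MIII : (k : ℕ) → Fin k → Fin (suc k) → Bool
MIII k = mat k (suc k) λ i j →
  if i ≡ᵇ k then (j ∈[ 2 , k ∸ 1 ]) ∨ (j ≡ᵇ suc k)
  else ((j ≡ᵇ i) ∨ (j ≡ᵇ suc i))

pattern O = false
pattern I = true

MIV : Fin 4 → Fin 6 → Bool
MIV = matV ((I ∷ I ∷ O ∷ O ∷ O ∷ O ∷ []) ∷
            (O ∷ O ∷ I ∷ I ∷ O ∷ O ∷ []) ∷
            (O ∷ O ∷ O ∷ O ∷ I ∷ I ∷ []) ∷
            (O ∷ I ∷ O ∷ I ∷ O ∷ I ∷ []) ∷ [])

MV : Fin 4 → Fin 5 → Bool
MV = matV ((I ∷ I ∷ O ∷ O ∷ O ∷ []) ∷
           (O ∷ O ∷ I ∷ I ∷ O ∷ []) ∷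
           (I ∷ I ∷ I ∷ I ∷ O ∷ []) ∷
           (I ∷ O ∷ O ∷ I ∷ I ∷ []) ∷ [])

F0 : Fin 3 → Fin 5 → Bool
F0 = matV ((I ∷ I ∷ I ∷ O ∷ O ∷ []) ∷
           (O ∷ I ∷ I ∷ I ∷ O ∷ []) ∷
           (O ∷ O ∷ I ∷ I ∷ I ∷ []) ∷ [])

F1 : (k : ℕ) → Fin k → Fin (k ∸ 1) → Bool
F1 k = mat k (k ∸ 1) λ i j →
  if i ≡ᵇ 1 then not (j ≡ᵇ 1)
  else if i ≡ᵇ 2 then not (j ≡ᵇ (k ∸ 1))
  else ((j ≡ᵇ (suc k ∸ i)) ∨ (j ≡ᵇ (suc (suc k) ∸ i)))

F2 : (k : ℕ) → Fin k → Fin k → Bool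
F2 k = mat k k λ i j →
  if i ≡ᵇ 1 then j ∈[ 2 , k ∸ 1 ]
  else ((j ≡ᵇ (i ∸ 1)) ∨ (j ≡ᵇ i))

-- k-sun: inj₁ i = v_{i+1} (clique), inj₂ i = w_{i+1} (independent),
-- w_i adjacent exactly to v_i, v_{i+1} (mod k).  (0-based here.)

sunW : (k : ℕ) → Fin k → Fin k → Bool
sunW k i j = (toℕ j ≡ᵇ toℕ i) ∨ (toℕ j ≡ᵇ suc (toℕ i)) ∨ ((suc (toℕ i) ≡ᵇ k) ∧ (toℕ j ≡ᵇ 0))

sun : (k : ℕ) → (Fin k ⊎ Fin k) → (Fin k ⊎ Fin k) → Bool
sun k (inj₁ i) (inj₁ j) = not (toℕ i ≡ᵇ toℕ j)
sun k (inj₂ i) (inj₂ j) = false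
sun k (inj₂ i) (inj₁ j) = sunW k i j
sun k (inj₁ j) (inj₂ i) = sunW k i j

sunCenter : (k : ℕ) → ((Fin k ⊎ Fin k) ⊎ ⊤) → ((Fin k ⊎ Fin k) ⊎ ⊤) → Bool
sunCenter k (inj₁ x) (inj₁ y) = sun k x y
sunCenter k (inj₁ (inj₁ _)) (inj₂ _) = true
sunCenter k (inj₁ (inj₂ _)) (inj₂ _) = false
sunCenter k (inj₂ _) (inj₁ (inj₁ _)) = true
sunCenter k (inj₂ _) (inj₁ (inj₂ _)) = false
sunCenter k (inj₂ _) (inj₂ _) = false

-- tent = 3-sun; tent ∨ K₁: extra vertex adjacent to all tent vertices
tentVeeK1 : ((Fin 3 ⊎ Fin 3) ⊎ ⊤) → ((Fin 3 ⊎ Fin 3) ⊎ ⊤) → Bool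
tentVeeK1 (inj₁ x) (inj₁ y) = sun 3 x y
tentVeeK1 (inj₁ _) (inj₂ _) = true
tentVeeK1 (inj₂ _) (inj₁ _) = true
tentVeeK1 (inj₂ _) (inj₂ _) = false

data InT : (V : Set) → (V → V → Bool) → Set₁ where
  tT     : InT _ tentVeeK1
  sunT   : ∀ k → 3 ≤ k → Odd k → InT _ (sunCenter k)
  MIT    : ∀ k → 3 ≤ k → ¬ Odd k → InT _ (GM (MI k))
  MIIT   : ∀ k → 4 ≤ k → InT _ (GM (MII k))
  MIIIT  : ∀ k → 3 ≤ k → ¬ (Odd k × 5 ≤ k) → InT _ (GM (MIII k))
  MIVT   : InT _ (GM MIV)
  MVT    : InT _ (GM MV)

data InF : (V : Set) → (V → V → Bool) → Set₁ where
  F0F : InF _ (GM F0)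
  F1F : ∀ k → 5 ≤ k → Odd k → InF _ (GM (F1 k))
  F2F : ∀ k → 5 ≤ k → Odd k → InF _ (GM (F2 k))

-- The sets K_1,…,K_6 (index i : Fin 6 stands for K_{i+1}).
-- Membership pattern = (adjacent to s13, adjacent to s35, adjacent to s51).

pat : Fin 6 → Bool × Bool × Bool
pat Fin.zero = (true , false , true)
pat (Fin.suc Fin.zero) = (true , false , false)
pat (Fin.suc (Fin.suc Fin.zero)) = (true , true , false)
pat (Fin.suc (Fin.suc (Fin.suc Fin.zero))) = (false , true , false)
pat (Fin.suc (Fin.suc (Fin.suc (Fin.suc Fin.zero)))) = (false , true , true)
pat (Fin.suc (Fin.suc (Fin.suc (Fin.suc (Fin.suc Fin.zero))))) = (false , false , true)

InPart : {n : ℕ} → (Fin n → Fin n → Bool) → (Fin n → Bool) →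
         (s13 s35 s51 : Fin n) → Fin 6 → Fin n → Set
InPart adj inK s13 s35 s51 i v =
  inK v ≡ true × (adj v s13 , adj v s35 , adj v s51) ≡ pat i

module Submission where

-- A clique vertex v sees some subset of the three sides s13, s35, s51 of the tent.
-- If it sees all of them, v and the tent induce tent ∨ K₁; if it sees none, they
-- induce the 3-sun with center (no corner sees all or none of the sides, so v is not
-- a corner).  Both graphs lie in 𝒯.  The six remaining subsets are exactly the
-- pairwise distinct patterns of K₁, …, K₆.

open import Defs
open import Data.Nat using (ℕ; _≡ᵇ_; s≤s; z≤n)
open import Data.Nat.Properties using (≡ᵇ⇒≡; ≡⇒≡ᵇ)
open import Data.Fin using (Fin; zero; suc; toℕ)
open import Data.Fin.Properties using (toℕ-injective)
open import Data.Bool using (Bool; true; false; not; T)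
open import Data.Sum using (_⊎_; inj₁; inj₂; [_,_])
open import Data.Unit using (⊤; tt)
open import Data.Product using (_×_; ∃; ∃!; _,_; proj₁; proj₂)
open import Data.Empty using (⊥; ⊥-elim)
open import Function using (const; _∘_)
open import Function.Definitions using (Injective)
open import Relation.Binary.PropositionalEquality
  using (_≡_; _≢_; refl; sym; trans; cong; subst)
open import Relation.Nullary using (¬_)

[,]-injective : {A B C : Set} {f : A → C} {g : B → C} →
  Injective _≡_ _≡_ f → Injective _≡_ _≡_ g → (∀ a b → f a ≢ g b) →
  Injective _≡_ _≡_ [ f , g ]
[,]-injective f-inj g-inj f≢g {inj₁ a} {inj₁ a′} e = cong inj₁ (f-inj e)
[,]-injective f-inj g-inj f≢g {inj₁ a} {inj₂ b}  e = ⊥-elim (f≢g a b e)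
[,]-injective f-inj g-inj f≢g {inj₂ b} {inj₁ a}  e = ⊥-elim (f≢g a b (sym e))
[,]-injective f-inj g-inj f≢g {inj₂ b} {inj₂ b′} e = cong inj₂ (g-inj e)

separated⇒≢ : {A : Set} (P : A → Bool) {u v : A} → P u ≡ true → P v ≡ false → u ≢ v
separated⇒≢ P Pu Pv refl with () ← trans (sym Pu) Pv

true≡b≡false : ∀ {x y b : Bool} → x ≡ b → y ≡ b → x ≡ true → y ≡ false → ⊥
true≡b≡false refl refl refl ()

Embeds-resp : {V : Set} {n : ℕ} {H H′ : V → V → Bool} {G : Fin n → Fin n → Bool} →
  (∀ x y → H x y ≡ H′ x y) → Embeds H G → Embeds H′ G
Embeds-resp H≗H′ (f , f-inj , f-pres) = f , f-inj , λ x y → trans (f-pres x y) (H≗H′ x y)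

extend : {V : Set} → (V → V → Bool) → (V → Bool) → V ⊎ ⊤ → V ⊎ ⊤ → Bool
extend H c (inj₁ x) (inj₁ y) = H x y
extend H c (inj₁ x) (inj₂ _) = c x
extend H c (inj₂ _) (inj₁ y) = c y
extend H c (inj₂ _) (inj₂ _) = false

extend-embeds : {V : Set} {n : ℕ} {H : V → V → Bool} {G : Fin n → Fin n → Bool} {c : V → Bool} →
  IsSimpleGraph G →
  (f : V → Fin n) → Injective _≡_ _≡_ f → (∀ x y → G (f x) (f y) ≡ H x y) →
  (v : Fin n) → (∀ x → f x ≢ v) → (∀ x → G (f x) v ≡ c x) →
  Embeds (extend H c) G
extend-embeds {H = H} {G} {c} (G-sym , G-irrefl) f f-inj f-pres v f≢v f-v =
  g , [,]-injective f-inj (λ _ → refl) (λ x _ → f≢v x) , g-pres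
  where
  g : _ ⊎ ⊤ → Fin _
  g = [ f , const v ]

  g-pres : ∀ x y → G (g x) (g y) ≡ extend H c x y
  g-pres (inj₁ x) (inj₁ y) = f-pres x y
  g-pres (inj₁ x) (inj₂ _) = f-v x
  g-pres (inj₂ _) (inj₁ y) = trans (G-sym v (f y)) (f-v y)
  g-pres (inj₂ _) (inj₂ _) = G-irrefl v

extend-sun≗tentVeeK1 : ∀ x y → extend (sun 3) [ const true , const true ] x y ≡ tentVeeK1 x y
extend-sun≗tentVeeK1 (inj₁ x)         (inj₁ y)         = refl
extend-sun≗tentVeeK1 (inj₁ (inj₁ _)) (inj₂ _)         = refl
extend-sun≗tentVeeK1 (inj₁ (inj₂ _)) (inj₂ _)         = refl
extend-sun≗tentVeeK1 (inj₂ _)         (inj₁ (inj₁ _)) = refl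
extend-sun≗tentVeeK1 (inj₂ _)         (inj₁ (inj₂ _)) = refl
extend-sun≗tentVeeK1 (inj₂ _)         (inj₂ _)         = refl

extend-sun≗sunCenter : ∀ k x y → extend (sun k) [ const true , const false ] x y ≡ sunCenter k x y
extend-sun≗sunCenter k (inj₁ x)         (inj₁ y)         = refl
extend-sun≗sunCenter k (inj₁ (inj₁ _)) (inj₂ _)         = refl
extend-sun≗sunCenter k (inj₁ (inj₂ _)) (inj₂ _)         = refl
extend-sun≗sunCenter k (inj₂ _)         (inj₁ (inj₁ _)) = refl
extend-sun≗sunCenter k (inj₂ _)         (inj₁ (inj₂ _)) = refl
extend-sun≗sunCenter k (inj₂ _)         (inj₂ _)         = refl

module SplitGraph {n : ℕ} {adj : Fin n → Fin n → Bool} {inK : Fin n → Bool}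
  (simple : IsSimpleGraph adj) (split : IsSplit adj inK) where

  adj-sym : ∀ u v → adj u v ≡ adj v u
  adj-sym = proj₁ simple

  clique-adj : ∀ {u v} → u ≢ v → inK u ≡ true → inK v ≡ true → adj u v ≡ true
  clique-adj = proj₁ split _ _

  independent-nonadj : ∀ {u v} → inK u ≡ false → inK v ≡ false → adj u v ≡ false
  independent-nonadj = proj₂ split _ _

  clique≢independent : ∀ {u v} → inK u ≡ true → inK v ≡ false → u ≢ v
  clique≢independent u∈K v∉K refl with () ← trans (sym u∈K) v∉K

  clique-complete : {k : ℕ} (κ : Fin k → Fin n) → Injective _≡_ _≡_ κ → (∀ i → inK (κ i) ≡ true) →
    ∀ i j → adj (κ i) (κ j) ≡ not (toℕ i ≡ᵇ toℕ j)
  clique-complete κ κ-inj κ∈K i j with toℕ i ≡ᵇ toℕ j in i≡ᵇj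
  ... | true  = subst (λ j → adj (κ i) (κ j) ≡ false)
                      (toℕ-injective (≡ᵇ⇒≡ _ _ (subst T (sym i≡ᵇj) tt)))
                      (proj₂ simple (κ i))
  ... | false = clique-adj (λ κi≡κj → subst T i≡ᵇj (≡⇒≡ᵇ _ _ (cong toℕ (κ-inj κi≡κj))))
                           (κ∈K i) (κ∈K j)

pat-index : Bool × Bool × Bool → Fin 6
pat-index (true  , false , true)  = zero
pat-index (true  , false , false) = suc zero
pat-index (true  , true  , false) = suc (suc zero)
pat-index (false , true  , false) = suc (suc (suc zero))
pat-index (false , true  , true)  = suc (suc (suc (suc zero)))
pat-index (false , false , true)  = suc (suc (suc (suc (suc zero))))
pat-index _                       = zero

pat-index-pat : ∀ i → pat-index (pat i) ≡ i
pat-index-pat zero                                = refl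
pat-index-pat (suc zero)                          = refl
pat-index-pat (suc (suc zero))                    = refl
pat-index-pat (suc (suc (suc zero)))              = refl
pat-index-pat (suc (suc (suc (suc zero))))        = refl
pat-index-pat (suc (suc (suc (suc (suc zero))))) = refl

pat-injective : ∀ {i j} → pat i ≡ pat j → i ≡ j
pat-injective {i} {j} e = trans (sym (pat-index-pat i)) (trans (cong pat-index e) (pat-index-pat j))

pat-covers : ∀ t → (∃ λ b → t ≡ (b , b , b)) ⊎ (∃ λ i → pat i ≡ t)
pat-covers (true  , true  , true)  = inj₁ (true , refl)
pat-covers (false , false , false) = inj₁ (false , refl)
pat-covers (true  , false , true)  = inj₂ (zero , refl)
pat-covers (true  , false , false) = inj₂ (suc zero , refl)
pat-covers (true  , true  , false) = inj₂ (suc (suc zero) , refl)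
pat-covers (false , true  , false) = inj₂ (suc (suc (suc zero)) , refl)
pat-covers (false , true  , true)  = inj₂ (suc (suc (suc (suc zero))) , refl)
pat-covers (false , false , true)  = inj₂ (suc (suc (suc (suc (suc zero)))) , refl)

module Tent {n : ℕ} {adj : Fin n → Fin n → Bool} {inK : Fin n → Bool}
  (simple : IsSimpleGraph adj) (split : IsSplit adj inK)
  {k1 k3 k5 s13 s35 s51 : Fin n}
  (k1∈K : inK k1 ≡ true) (k3∈K : inK k3 ≡ true) (k5∈K : inK k5 ≡ true)
  (s13∉K : inK s13 ≡ false) (s35∉K : inK s35 ≡ false) (s51∉K : inK s51 ≡ false)
  (s13k1 : adj s13 k1 ≡ true) (s13k3 : adj s13 k3 ≡ true) (s13k5 : adj s13 k5 ≡ false)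
  (s35k3 : adj s35 k3 ≡ true) (s35k5 : adj s35 k5 ≡ true) (s35k1 : adj s35 k1 ≡ false)
  (s51k5 : adj s51 k5 ≡ true) (s51k1 : adj s51 k1 ≡ true) (s51k3 : adj s51 k3 ≡ false)
  where

  open SplitGraph simple split

  corner : Fin 3 → Fin n
  corner zero             = k1
  corner (suc zero)       = k3
  corner (suc (suc zero)) = k5

  side : Fin 3 → Fin n
  side zero             = s13
  side (suc zero)       = s35
  side (suc (suc zero)) = s51

  corner∈K : ∀ i → inK (corner i) ≡ true
  corner∈K zero             = k1∈K
  corner∈K (suc zero)       = k3∈K
  corner∈K (suc (suc zero)) = k5∈K

  side∉K : ∀ j → inK (side j) ≡ false
  side∉K zero             = s13∉K
  side∉K (suc zero)       = s35∉K
  side∉K (suc (suc zero)) = s51∉K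

  side-corner : ∀ j i → adj (side j) (corner i) ≡ sunW 3 j i
  side-corner zero             zero             = s13k1
  side-corner zero             (suc zero)       = s13k3
  side-corner zero             (suc (suc zero)) = s13k5
  side-corner (suc zero)       zero             = s35k1
  side-corner (suc zero)       (suc zero)       = s35k3
  side-corner (suc zero)       (suc (suc zero)) = s35k5
  side-corner (suc (suc zero)) zero             = s51k1
  side-corner (suc (suc zero)) (suc zero)       = s51k3
  side-corner (suc (suc zero)) (suc (suc zero)) = s51k5

  corner-injective : Injective _≡_ _≡_ corner
  corner-injective {zero}           {zero}           _ = refl
  corner-injective {suc zero}       {suc zero}       _ = refl
  corner-injective {suc (suc zero)} {suc (suc zero)} _ = refl
  corner-injective {zero}           {suc zero}       e = ⊥-elim (separated⇒≢ (adj s35) s35k3 s35k1 (sym e))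
  corner-injective {suc zero}       {zero}           e = ⊥-elim (separated⇒≢ (adj s35) s35k3 s35k1 e)
  corner-injective {zero}           {suc (suc zero)} e = ⊥-elim (separated⇒≢ (adj s35) s35k5 s35k1 (sym e))
  corner-injective {suc (suc zero)} {zero}           e = ⊥-elim (separated⇒≢ (adj s35) s35k5 s35k1 e)
  corner-injective {suc zero}       {suc (suc zero)} e = ⊥-elim (separated⇒≢ (adj s13) s13k3 s13k5 e)
  corner-injective {suc (suc zero)} {suc zero}       e = ⊥-elim (separated⇒≢ (adj s13) s13k3 s13k5 (sym e))

  side-injective : Injective _≡_ _≡_ side
  side-injective {zero}           {zero}           _ = refl
  side-injective {suc zero}       {suc zero}       _ = refl
  side-injective {suc (suc zero)} {suc (suc zero)} _ = refl
  side-injective {zero}           {suc zero}       e = ⊥-elim (separated⇒≢ (λ s → adj s k1) s13k1 s35k1 e)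
  side-injective {suc zero}       {zero}           e = ⊥-elim (separated⇒≢ (λ s → adj s k1) s13k1 s35k1 (sym e))
  side-injective {zero}           {suc (suc zero)} e = ⊥-elim (separated⇒≢ (λ s → adj s k3) s13k3 s51k3 e)
  side-injective {suc (suc zero)} {zero}           e = ⊥-elim (separated⇒≢ (λ s → adj s k3) s13k3 s51k3 (sym e))
  side-injective {suc zero}       {suc (suc zero)} e = ⊥-elim (separated⇒≢ (λ s → adj s k3) s35k3 s51k3 e)
  side-injective {suc (suc zero)} {suc zero}       e = ⊥-elim (separated⇒≢ (λ s → adj s k3) s35k3 s51k3 (sym e))

  tent : Fin 3 ⊎ Fin 3 → Fin n
  tent = [ corner , side ]

  tent-injective : Injective _≡_ _≡_ tent
  tent-injective = [,]-injective corner-injective side-injective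
                                 (λ i j → clique≢independent (corner∈K i) (side∉K j))

  tent-adj : ∀ x y → adj (tent x) (tent y) ≡ sun 3 x y
  tent-adj (inj₁ i) (inj₁ j) = clique-complete corner corner-injective corner∈K i j
  tent-adj (inj₁ i) (inj₂ j) = trans (adj-sym (corner i) (side j)) (side-corner j i)
  tent-adj (inj₂ j) (inj₁ i) = side-corner j i
  tent-adj (inj₂ i) (inj₂ j) = independent-nonadj (side∉K i) (side∉K j)

  corner-not-uniform : ∀ i {b} → ¬ (∀ j → adj (side j) (corner i) ≡ b)
  corner-not-uniform zero             sees = true≡b≡false (sees zero) (sees (suc zero)) s13k1 s35k1
  corner-not-uniform (suc zero)       sees = true≡b≡false (sees zero) (sees (suc (suc zero))) s13k3 s51k3
  corner-not-uniform (suc (suc zero)) sees = true≡b≡false (sees (suc zero)) (sees zero) s35k5 s13k5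

  uniform-extend-embeds : ∀ v → inK v ≡ true → ∀ {b} → (∀ j → adj (side j) v ≡ b) →
    Embeds (extend (sun 3) [ const true , const b ]) adj
  uniform-extend-embeds v v∈K {b} sees =
    extend-embeds simple tent tent-injective tent-adj v tent≢v tent-v
    where
    tent≢v : ∀ x → tent x ≢ v
    tent≢v (inj₁ i) refl = corner-not-uniform i sees
    tent≢v (inj₂ j) e    = clique≢independent v∈K (side∉K j) (sym e)

    tent-v : ∀ x → adj (tent x) v ≡ [ const true , const b ] x
    tent-v (inj₁ i) = clique-adj (tent≢v (inj₁ i)) (corner∈K i) v∈K
    tent-v (inj₂ j) = sees j

  profile : Fin n → Bool × Bool × Bool
  profile v = (adj v s13 , adj v s35 , adj v s51)

  uniform-profile⇒sides-see : ∀ {v b} → profile v ≡ (b , b , b) → ∀ j → adj (side j) v ≡ b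
  uniform-profile⇒sides-see {v} e j = trans (adj-sym (side j) v) (component j e)
    where
    component : ∀ {b} j → profile v ≡ (b , b , b) → adj v (side j) ≡ b
    component zero             = cong proj₁
    component (suc zero)       = cong (proj₁ ∘ proj₂)
    component (suc (suc zero)) = cong (proj₂ ∘ proj₂)

  no-uniform-profile : (∀ (V : Set) (H : V → V → Bool) → InT V H → ¬ Embeds H adj) →
    ∀ v → inK v ≡ true → ∀ b → profile v ≢ (b , b , b)
  no-uniform-profile no-T v v∈K b uniform =
    forbidden b (uniform-extend-embeds v v∈K (uniform-profile⇒sides-see uniform))
    where
    forbidden : ∀ b → ¬ Embeds (extend (sun 3) [ const true , const b ]) adj
    forbidden true  = no-T _ _ tT ∘ Embeds-resp {G = adj} extend-sun≗tentVeeK1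
    forbidden false = no-T _ _ (sunT 3 (s≤s (s≤s (s≤s z≤n))) (1 , refl))
                    ∘ Embeds-resp {G = adj} (extend-sun≗sunCenter 3)

  clique-vertex-in-unique-part : (∀ (V : Set) (H : V → V → Bool) → InT V H → ¬ Embeds H adj) →
    ∀ v → inK v ≡ true → ∃! _≡_ (λ i → InPart adj inK s13 s35 s51 i v)
  clique-vertex-in-unique-part no-T v v∈K with pat-covers (profile v)
  ... | inj₁ (b , uniform) = ⊥-elim (no-uniform-profile no-T v v∈K b uniform)
  ... | inj₂ (i , pat≡profile) =
    i , (v∈K , sym pat≡profile) , λ (_ , profile≡pat) → pat-injective (trans pat≡profile profile≡pat)

mainTheorem4 : (n : ℕ) (adj : Fin n → Fin n → Bool) (inK : Fin n → Bool) →
    IsSimpleGraph adj → IsSplit adj inK →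
    (k1 k3 k5 s13 s35 s51 : Fin n) →
    inK k1 ≡ true → inK k3 ≡ true → inK k5 ≡ true →
    inK s13 ≡ false → inK s35 ≡ false → inK s51 ≡ false →
    adj s13 k1 ≡ true → adj s13 k3 ≡ true → adj s13 k5 ≡ false →
    adj s35 k3 ≡ true → adj s35 k5 ≡ true → adj s35 k1 ≡ false →
    adj s51 k5 ≡ true → adj s51 k1 ≡ true → adj s51 k3 ≡ false →
    (∀ (V : Set) (H : V → V → Bool) → InT V H → ¬ Embeds H adj) →
    (∀ (V : Set) (H : V → V → Bool) → InF V H → ¬ Embeds H adj) →
    ∀ (v : Fin n) → inK v ≡ true → ∃! _≡_ (λ i → InPart adj inK s13 s35 s51 i v)
mainTheorem4 _ _ _ simple split _ _ _ _ _ _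
  k1∈K k3∈K k5∈K s13∉K s35∉K s51∉K s13k1 s13k3 s13k5 s35k3 s35k5 s35k1 s51k5 s51k1 s51k3 no-T _ =
  Tent.clique-vertex-in-unique-part simple split k1∈K k3∈K k5∈K s13∉K s35∉K s51∉K
    s13k1 s13k3 s13k5 s35k3 s35k5 s35k1 s51k5 s51k1 s51k3 no-T
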